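{- Let $(P,\varphi)$ be a closure space of semilattice type whose underlying poset $P$ is well-founded. Then $\operatorname{Clop}(P,\varphi)$ is a lattice if and only if $\operatorname{Clop}(P,\varphi)=\operatorname{Reg}(P,\varphi)$.
   Context: A closure operator $\varphi$ on a set $P$ is extensive, idempotent, isotone with $\varphi(\varnothing)=\varnothing$; it is algebraic if $\varphi(\boldsymbol{x})$ is the union of $\varphi(\boldsymbol{y})$ for finite $\boldsymbol{y}\subseteq\boldsymbol{x}$. A minimal covering of $p$ is a set $\boldsymbol{x}$, minimal under inclusion, with $p\in\varphi(\boldsymbol{x})$. An algebraic closure space $(P,\varphi)$ with $P$ a poset has semilattice type if for every $p$ and every minimal covering $\boldsymbol{x}$ of $p$, $p$ is the join of $\boldsymbol{x}$ in $P$. Well-founded: every nonempty subset of $P$ has a minimal element. $\check\varphi(\boldsymbol{x})=P\setminus\varphi(P\setminus\boldsymbol{x})$; clopen means $\varphi(\boldsymbol{x})=\boldsymbol{x}=\check\varphi(\boldsymbol{x})$; regular closed means $\boldsymbol{x}=\varphi\check\varphi(\boldsymbol{x})$. $\operatorname{Clop}(P,\varphi)$ and $\operatorname{Reg}(P,\varphi)$ are the sets of clopen, resp. regular closed, subsets ordered by inclusion. -}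

module Defs where

open import Level using (0ℓ)
open import Data.Product using (Σ; ∃; _×_; _,_)
open import Data.List using (List)
open import Data.List.Relation.Unary.All using (All)
open import Data.List.Membership.Propositional using (_∈_)
open import Relation.Nullary using (¬_; Dec)
open import Relation.Binary.PropositionalEquality using (_≡_)
open import Relation.Binary.Structures using (IsPartialOrder)

Subset : Set → Set₁
Subset P = P → Set

module _ {P : Set} where

  ∅ : Subset P
  ∅ _ = Data.Empty.⊥
    where import Data.Empty

  _⊆_ : Subset P → Subset P → Set
  x ⊆ y = ∀ p → x p → y p

  _≐_ : Subset P → Subset P → Set
  x ≐ y = (x ⊆ y) × (y ⊆ x)

  ∁ : Subset P → Subset P
  ∁ x p = ¬ x p

  ⟦_⟧ : List P → Subset P
  ⟦ ys ⟧ q = q ∈ ys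

ExcludedMiddle : Set₁
ExcludedMiddle = (A : Set) → Dec A

record IsClosureOperator {P : Set} (φ : Subset P → Subset P) : Set₁ where
  field
    extensive  : ∀ x → x ⊆ φ x
    idempotent : ∀ x → φ (φ x) ≐ φ x
    isotone    : ∀ x y → x ⊆ y → φ x ⊆ φ y
    empty      : φ ∅ ≐ ∅

-- Algebraic: φ(x) is the union of φ(y) over finite y ⊆ x.
IsAlgebraic : {P : Set} → (Subset P → Subset P) → Set₁
IsAlgebraic {P} φ =
  ∀ (x : Subset P) (p : P) →
    (φ x p → Σ (List P) λ ys → All x ys × φ ⟦ ys ⟧ p)
    × ((Σ (List P) λ ys → All x ys × φ ⟦ ys ⟧ p) → φ x p)

module _ {P : Set} (φ : Subset P → Subset P) where

  IsMinimalCovering : P → Subset P → Set₁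
  IsMinimalCovering p x = φ x p × (∀ y → y ⊆ x → φ y p → x ⊆ y)

  φ̌ : Subset P → Subset P
  φ̌ x = ∁ (φ (∁ x))

  IsClopen : Subset P → Set
  IsClopen x = (φ x ≐ x) × (x ≐ φ̌ x)

  IsRegularClosed : Subset P → Set
  IsRegularClosed x = x ≐ φ (φ̌ x)

  ClopIsLattice : Set₁
  ClopIsLattice =
    ∀ (a b : Subset P) → IsClopen a → IsClopen b →
      (Σ (Subset P) λ j → IsClopen j × a ⊆ j × b ⊆ j
         × (∀ c → IsClopen c → a ⊆ c → b ⊆ c → j ⊆ c))
      × (Σ (Subset P) λ m → IsClopen m × m ⊆ a × m ⊆ b
         × (∀ c → IsClopen c → c ⊆ a → c ⊆ b → c ⊆ m))

  ClopEqualsReg : Set₁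
  ClopEqualsReg = ∀ (x : Subset P) → (IsClopen x → IsRegularClosed x)
                                    × (IsRegularClosed x → IsClopen x)

module _ {P : Set} (_≤_ : P → P → Set) where

  IsJoin : Subset P → P → Set
  IsJoin x p = (∀ q → x q → q ≤ p) × (∀ u → (∀ q → x q → q ≤ u) → p ≤ u)

  IsWellFounded : Set₁
  IsWellFounded = ∀ (S : Subset P) → ∃ S →
    Σ P λ m → S m × (∀ q → S q → q ≤ m → q ≡ m)

  HasSemilatticeType : (Subset P → Subset P) → Set₁
  HasSemilatticeType φ = ∀ (p : P) (x : Subset P) → IsMinimalCovering φ p x → IsJoin x p

-- The regular closed sets always form a lattice: the join of a and b is φ(φ̌(φ(a ∪ b)))
-- and the meet is φ(φ̌(a ∩ b)).  So if Clop = Reg, Clop is a lattice.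
--
-- Conversely, let Clop be a lattice and a regular closed, hence closed.  If a were not open,
-- well-foundedness gives a minimal p ∈ a ∩ φ(∁ a), so a ∩ ↓t ⊆ φ̌(a) for all t < p.  This
-- makes a ∩ ↓t and ↓t ⇒ a clopen for t < p.  Covering p by finitely many t ∈ φ̌(a)
-- (algebraicity), the clopen join J of the sets a ∩ ↓t contains p.  Covering p by points
-- s ∈ ∁ a, J lies below each clopen ↓s ⇒ a ⊇ a, which excludes s from J, so p ∈ φ(∁ J) too,
-- contradicting openness of J.  Both coverings may be taken minimal, so by semilattice type
-- their points lie below p.
module Submission where

open import Defs
open import Data.Product using (Σ; _×_; _,_; proj₁; proj₂)
open import Data.Sum using (_⊎_; inj₁; inj₂; [_,_])
open import Data.Empty using (⊥-elim)
open import Data.List using (List; []; _∷_)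
open import Data.List.Relation.Unary.All as All using (All)
open import Data.List.Relation.Unary.Any using (here; there)
open import Data.List.Membership.Propositional using (_∈_)
open import Relation.Nullary using (¬_; yes; no)
open import Relation.Nullary.Decidable using (decidable-stable)
open import Relation.Binary.PropositionalEquality using (_≡_; refl)
open import Relation.Binary.Structures using (IsPartialOrder)

module _ {P : Set} where

  infixr 25 _∩_ _∪_ _⇒_

  _∩_ : Subset P → Subset P → Subset P
  (x ∩ y) q = x q × y q

  _∪_ : Subset P → Subset P → Subset P
  (x ∪ y) q = x q ⊎ y q

  _⇒_ : Subset P → Subset P → Subset P
  (x ⇒ y) q = x q → y q

  _∖_ : Subset P → P → Subset P
  (x ∖ r) q = x q × ¬ q ≡ r

module _ {P : Set} (φ : Subset P → Subset P) where

  IsClosed : Subset P → Set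
  IsClosed x = φ x ⊆ x

  IsOpen : Subset P → Set
  IsOpen x = x ⊆ φ̌ φ x

module _ (em : ExcludedMiddle) where

  ¬¬-elim : {A : Set} → ¬ ¬ A → A
  ¬¬-elim {A} = decidable-stable (em A)

  ¬→-witness : {A B : Set} → ¬ (A → B) → A × ¬ B
  ¬→-witness ¬A→B = ¬¬-elim (λ ¬A → ¬A→B λ a → ⊥-elim (¬A a)) , λ b → ¬A→B λ _ → b

  module Pruning {P : Set} (F : Subset P → Set)
                 (F-mono : ∀ {y z} → y ⊆ z → F y → F z) where

    prune : Subset P → List P → Subset P
    prune S []       = S
    prune S (r ∷ rs) with em (F (S ∖ r))
    ... | yes _ = prune (S ∖ r) rs
    ... | no  _ = prune S rs

    prune-⊆ : ∀ S rs → prune S rs ⊆ S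
    prune-⊆ S []       q Sq = Sq
    prune-⊆ S (r ∷ rs) with em (F (S ∖ r))
    ... | yes _ = λ q h → proj₁ (prune-⊆ (S ∖ r) rs q h)
    ... | no  _ = prune-⊆ S rs

    prune-preserves : ∀ S rs → F S → F (prune S rs)
    prune-preserves S []       FS = FS
    prune-preserves S (r ∷ rs) FS with em (F (S ∖ r))
    ... | yes FS∖r = prune-preserves (S ∖ r) rs FS∖r
    ... | no  _    = prune-preserves S rs FS

    prune-minimal : ∀ S rs {y} → y ⊆ prune S rs → F y →
                    ∀ {q} → q ∈ rs → prune S rs q → y q
    prune-minimal S (r ∷ rs) {y} y⊆ Fy q∈ pq with em (F (S ∖ r)) | q∈
    ... | yes _   | here refl = ⊥-elim (proj₂ (prune-⊆ (S ∖ r) rs _ pq) refl)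
    ... | yes _   | there q∈' = prune-minimal (S ∖ r) rs y⊆ Fy q∈' pq
    ... | no  _   | there q∈' = prune-minimal S rs y⊆ Fy q∈' pq
    ... | no  ¬FS∖r | here refl with em (y r)
    ...   | yes yr = yr
    ...   | no ¬yr = ⊥-elim (¬FS∖r (F-mono y⊆S∖r Fy))
      where
      y⊆S∖r : y ⊆ (S ∖ r)
      y⊆S∖r w yw = prune-⊆ S rs w (y⊆ w yw) , λ { refl → ¬yr yw }

  module _ {P : Set} {φ : Subset P → Subset P} (cl : IsClosureOperator φ) where

    open IsClosureOperator cl

    minimal-subcovering : IsAlgebraic φ → ∀ {x q} → φ x q →
                          Σ (Subset P) λ m → m ⊆ x × IsMinimalCovering φ q m
    minimal-subcovering alg {x} {q} φxq with proj₁ (alg x q) φxq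
    ... | ys , ys⊆x , φys =
      m , (λ r mr → All.lookup ys⊆x (m⊆ys r mr)) , prune-preserves ⟦ ys ⟧ ys φys ,
      λ y y⊆m φy r mr → prune-minimal ⟦ ys ⟧ ys y⊆m φy (m⊆ys r mr) mr
      where
      open Pruning (λ y → φ y q) (λ y⊆z → isotone _ _ y⊆z q)
      m : Subset P
      m = prune ⟦ ys ⟧ ys
      m⊆ys : m ⊆ ⟦ ys ⟧
      m⊆ys = prune-⊆ ⟦ ys ⟧ ys

    φ̌-isotone : ∀ {x y} → x ⊆ y → φ̌ φ x ⊆ φ̌ φ y
    φ̌-isotone x⊆y q ¬φ∁x φ∁y = ¬φ∁x (isotone _ _ (λ r ¬yr xr → ¬yr (x⊆y r xr)) q φ∁y)

    φ̌-deflationary : ∀ x → φ̌ φ x ⊆ x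
    φ̌-deflationary x q ¬φ∁x = ¬¬-elim λ ¬xq → ¬φ∁x (extensive (∁ x) q ¬xq)

    φ̌-open : ∀ x → IsOpen φ (φ̌ φ x)
    φ̌-open x q ¬φ∁x φ∁φ̌x =
      ¬φ∁x (proj₁ (idempotent (∁ x)) q (isotone _ _ (λ r → ¬¬-elim) q φ∁φ̌x))

    open-⊆-φ̌ : ∀ {c x} → IsOpen φ c → c ⊆ x → c ⊆ φ̌ φ x
    open-⊆-φ̌ c-open c⊆x q cq = φ̌-isotone c⊆x q (c-open q cq)

    open-⊆-φφ̌ : ∀ {c x} → IsOpen φ c → c ⊆ x → c ⊆ φ (φ̌ φ x)
    open-⊆-φφ̌ c-open c⊆x q cq = extensive _ q (open-⊆-φ̌ c-open c⊆x q cq)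

    φφ̌-⊆-closed : ∀ {c x} → IsClosed φ c → x ⊆ c → φ (φ̌ φ x) ⊆ c
    φφ̌-⊆-closed c-closed x⊆c q φφ̌xq =
      c-closed q (isotone _ _ (λ r φ̌xr → x⊆c r (φ̌-deflationary _ r φ̌xr)) q φφ̌xq)

    clopen : ∀ {x} → IsClosed φ x → IsOpen φ x → IsClopen φ x
    clopen {x} x-closed x-open = (x-closed , extensive x) , (x-open , φ̌-deflationary x)

    clopen⇒closed : ∀ {x} → IsClopen φ x → IsClosed φ x
    clopen⇒closed ((φx⊆x , _) , _) = φx⊆x

    clopen⇒open : ∀ {x} → IsClopen φ x → IsOpen φ x
    clopen⇒open (_ , (x⊆φ̌x , _)) = x⊆φ̌x

    ∅-clopen : IsClopen φ ∅
    ∅-clopen = clopen (proj₁ empty) (λ q ())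

    clopen⇒regularClosed : ∀ {x} → IsClopen φ x → IsRegularClosed φ x
    clopen⇒regularClosed x-clopen =
      open-⊆-φφ̌ (clopen⇒open x-clopen) (λ q xq → xq) ,
      φφ̌-⊆-closed (clopen⇒closed x-clopen) (λ q xq → xq)

    regularClosed⇒closed : ∀ {x} → IsRegularClosed φ x → IsClosed φ x
    regularClosed⇒closed (x⊆φφ̌x , φφ̌x⊆x) q φxq =
      φφ̌x⊆x q (proj₁ (idempotent _) q (isotone _ _ x⊆φφ̌x q φxq))

    φφ̌-regularClosed : ∀ x → IsRegularClosed φ (φ (φ̌ φ x))
    φφ̌-regularClosed x =
      isotone _ _ (open-⊆-φ̌ (φ̌-open x) (extensive (φ̌ φ x))) ,
      φφ̌-⊆-closed (λ q → proj₁ (idempotent (φ̌ φ x)) q) (λ q φφ̌xq → φφ̌xq)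

    clopEqualsReg⇒clopIsLattice : ClopEqualsReg φ → ClopIsLattice φ
    clopEqualsReg⇒clopIsLattice E a b a-clopen b-clopen =
      ( φ (φ̌ φ (φ (a ∪ b))) , regular⇒clopen (φφ̌-regularClosed _)
      , open-⊆-φφ̌ (clopen⇒open a-clopen) (λ q aq → extensive _ q (inj₁ aq))
      , open-⊆-φφ̌ (clopen⇒open b-clopen) (λ q bq → extensive _ q (inj₂ bq))
      , λ c c-clopen a⊆c b⊆c →
          φφ̌-⊆-closed (clopen⇒closed c-clopen)
            (λ q φa∪bq → clopen⇒closed c-clopen q
               (isotone _ _ (λ r → [ a⊆c r , b⊆c r ]) q φa∪bq)) )
      , ( φ (φ̌ φ (a ∩ b)) , regular⇒clopen (φφ̌-regularClosed _)
        , φφ̌-⊆-closed (clopen⇒closed a-clopen) (λ q → proj₁)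
        , φφ̌-⊆-closed (clopen⇒closed b-clopen) (λ q → proj₂)
        , λ c c-clopen c⊆a c⊆b →
            open-⊆-φφ̌ (clopen⇒open c-clopen) (λ q cq → c⊆a q cq , c⊆b q cq) )
      where
      regular⇒clopen : ∀ {x} → IsRegularClosed φ x → IsClopen φ x
      regular⇒clopen {x} = proj₂ (E x)

    clop-finiteJoin : ClopIsLattice φ → {A : Set} (f : A → Subset P) →
      ∀ ts → All (λ t → IsClopen φ (f t)) ts →
      Σ (Subset P) λ J → IsClopen φ J × (∀ {t} → t ∈ ts → f t ⊆ J)
        × (∀ K → IsClopen φ K → (∀ {t} → t ∈ ts → f t ⊆ K) → J ⊆ K)
    clop-finiteJoin L f [] All.[] = ∅ , ∅-clopen , (λ ()) , λ K _ _ q ()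
    clop-finiteJoin L f (t ∷ ts) (ft-clopen All.∷ fts-clopen)
      with clop-finiteJoin L f ts fts-clopen
    ... | J , J-clopen , fts⊆J , J-least
      with proj₁ (L J (f t) J-clopen ft-clopen)
    ... | j , j-clopen , J⊆j , ft⊆j , j-least =
      j , j-clopen , bound ,
      λ K K-clopen f⊆K → j-least K K-clopen (J-least K K-clopen (λ t∈ → f⊆K (there t∈)))
                                 (f⊆K (here refl))
      where
      bound : ∀ {t'} → t' ∈ (t ∷ ts) → f t' ⊆ j
      bound (here refl) = ft⊆j
      bound (there t∈) q ft'q = J⊆j q (fts⊆J t∈ q ft'q)

module _ (em : ExcludedMiddle) {P : Set} {_≤_ : P → P → Set} (po : IsPartialOrder _≡_ _≤_)
         {φ : Subset P → Subset P} (cl : IsClosureOperator φ) (alg : IsAlgebraic φ)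
         (slt : HasSemilatticeType _≤_ φ) where

  open IsClosureOperator cl
  open IsPartialOrder po using ()
    renaming (refl to ≤-refl; trans to ≤-trans; antisym to ≤-antisym)

  infix 30 ↓_

  ↓_ : P → Subset P
  (↓ t) q = q ≤ t

  joined-subcovering : ∀ {x q} → φ x q → Σ (Subset P) λ m → m ⊆ x × φ m q × IsJoin _≤_ m q
  joined-subcovering φxq with minimal-subcovering em cl alg φxq
  ... | m , m⊆x , m-minimal = m , m⊆x , proj₁ m-minimal , slt _ m m-minimal

  covering-≤ : ∀ {x q u} → φ x q → x ⊆ ↓ u → q ≤ u
  covering-≤ φxq x⊆↓u with joined-subcovering φxq
  ... | m , m⊆x , _ , _ , m-least = m-least _ λ r mr → x⊆↓u r (m⊆x r mr)

  closed∩↓-clopen : ∀ {a t} → IsClosed φ a → a ∩ ↓ t ⊆ φ̌ φ a → IsClopen φ (a ∩ ↓ t)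
  closed∩↓-clopen {a} {t} a-closed open-below =
    clopen em cl (λ q φq → a-closed q (isotone _ _ (λ _ → proj₁) q φq)
                         , covering-≤ φq (λ _ → proj₂))
                 (λ q (aq , q≤t) φ∁q → open-below q (aq , q≤t) (φ∁a-below φ∁q q≤t))
    where
    φ∁a-below : ∀ {q} → φ (∁ (a ∩ ↓ t)) q → q ≤ t → φ (∁ a) q
    φ∁a-below φ∁q q≤t with joined-subcovering φ∁q
    ... | n , n⊆ , φn , n≤q , _ =
      isotone _ _ (λ r nr ar → n⊆ r nr (ar , ≤-trans (n≤q r nr) q≤t)) _ φn

  ↓⇒closed-clopen : ∀ {a s} → IsClosed φ a → a ∩ ↓ s ⊆ φ̌ φ a → IsClopen φ (↓ s ⇒ a)
  ↓⇒closed-clopen {a} {s} a-closed open-below = clopen em cl is-closed is-open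
    where
    is-closed : IsClosed φ (↓ s ⇒ a)
    is-closed q φq q≤s with joined-subcovering φq
    ... | n , n⊆ , φn , n≤q , _ =
      a-closed q (isotone _ _ (λ r nr → n⊆ r nr (≤-trans (n≤q r nr) q≤s)) q φn)
    is-open : ∀ q → (↓ s ⇒ a) q → ¬ φ (∁ (↓ s ⇒ a)) q
    is-open q s⇒aq φ∁q with joined-subcovering φ∁q
    ... | n , n⊆ , φn , _ , n-least =
      open-below q (s⇒aq q≤s , q≤s) (isotone _ _ (λ r nr → proj₂ (outside r nr)) q φn)
      where
      outside : ∀ r → n r → r ≤ s × ¬ a r
      outside r nr = ¬→-witness em (n⊆ r nr)
      q≤s : q ≤ s
      q≤s = n-least s λ r nr → proj₁ (outside r nr)

  finite-subcovering-below : ∀ {x p} → φ x p →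
                             Σ (List P) λ ys → All (x ∩ ↓ p) ys × φ ⟦ ys ⟧ p
  finite-subcovering-below {x} {p} φxp with joined-subcovering φxp
  ... | m , m⊆x , φmp , m≤p , _ with proj₁ (alg m p) φmp
  ... | ys , ys⊆m , φys = ys , All.map (λ {t} mt → m⊆x t mt , m≤p t mt) ys⊆m , φys

  module _ (L : ClopIsLattice φ) {a : Subset P} {p : P} (a-closed : IsClosed φ a)
           (open-below : ∀ {t} → t ≤ p → ¬ t ≡ p → a ∩ ↓ t ⊆ φ̌ φ a)
           (ap : a p) (φ∁ap : φ (∁ a) p) where

    interior-piece-clopen : ∀ {t} → (φ̌ φ a ∩ ↓ p) t → IsClopen φ (a ∩ ↓ t)
    interior-piece-clopen (φ̌at , t≤p) =
      closed∩↓-clopen a-closed (open-below t≤p λ { refl → φ̌at φ∁ap })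

    exterior-piece-clopen : ∀ {s} → (∁ a ∩ ↓ p) s → IsClopen φ (↓ s ⇒ a)
    exterior-piece-clopen (¬as , s≤p) =
      ↓⇒closed-clopen a-closed (open-below s≤p λ { refl → ¬as ap })

    not-in-φφ̌ : ¬ φ (φ̌ φ a) p
    not-in-φφ̌ φφ̌ap with finite-subcovering-below φφ̌ap
    ... | ys , ys-inside , φys
      with clop-finiteJoin em cl L (λ t → a ∩ ↓ t) ys (All.map interior-piece-clopen ys-inside)
    ... | J , J-clopen , pieces⊆J , J-least = clopen⇒open em cl J-clopen p Jp φ∁Jp
      where
      Jp : J p
      Jp = clopen⇒closed em cl J-clopen p (isotone _ _ ys⊆J p φys)
        where
        ys⊆J : ⟦ ys ⟧ ⊆ J
        ys⊆J t t∈ =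
          pieces⊆J t∈ t (φ̌-deflationary em cl a t (proj₁ (All.lookup ys-inside t∈)) , ≤-refl)
      φ∁Jp : φ (∁ J) p
      φ∁Jp with joined-subcovering φ∁ap
      ... | n , n⊆∁a , φnp , n≤p , _ = isotone _ _ n⊆∁J p φnp
        where
        n⊆∁J : n ⊆ ∁ J
        n⊆∁J s ns Js = n⊆∁a s ns (J⊆↓s⇒a s Js ≤-refl)
          where
          J⊆↓s⇒a : J ⊆ ↓ s ⇒ a
          J⊆↓s⇒a = J-least (↓ s ⇒ a) (exterior-piece-clopen (n⊆∁a s ns , n≤p s ns))
                           (λ _ q (aq , _) _ → aq)

  regularClosed-open : IsWellFounded _≤_ → ClopIsLattice φ →
                       ∀ {a} → IsRegularClosed φ a → IsOpen φ a
  regularClosed-open wf L {a} a-regular q aq φ∁aq with wf (a ∩ φ (∁ a)) (q , aq , φ∁aq)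
  ... | p , (ap , φ∁ap) , p-minimal =
    not-in-φφ̌ L (regularClosed⇒closed em cl a-regular) open-below ap φ∁ap (proj₁ a-regular p ap)
    where
    open-below : ∀ {t} → t ≤ p → ¬ t ≡ p → a ∩ ↓ t ⊆ φ̌ φ a
    open-below t≤p t≢p r (ar , r≤t) φ∁ar with p-minimal r (ar , φ∁ar) (≤-trans r≤t t≤p)
    ... | refl = t≢p (≤-antisym t≤p r≤t)

  clopIsLattice⇒clopEqualsReg : IsWellFounded _≤_ → ClopIsLattice φ → ClopEqualsReg φ
  clopIsLattice⇒clopEqualsReg wf L x =
    clopen⇒regularClosed em cl ,
    λ x-regular → clopen em cl (regularClosed⇒closed em cl x-regular)
                               (regularClosed-open wf L x-regular)

theorem16p3 : ExcludedMiddle →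
    (P : Set) (_≤_ : P → P → Set) → IsPartialOrder _≡_ _≤_ →
    (φ : Subset P → Subset P) → IsClosureOperator φ → IsAlgebraic φ →
    HasSemilatticeType _≤_ φ → IsWellFounded _≤_ →
    (ClopIsLattice φ → ClopEqualsReg φ) × (ClopEqualsReg φ → ClopIsLattice φ)
theorem16p3 em P _≤_ po φ cl alg slt wf =
  clopIsLattice⇒clopEqualsReg em po cl alg slt wf , clopEqualsReg⇒clopIsLattice em cl
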